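{- There is no family $\mathcal{F}$ of graphs such that, for every graph $G$, $G$ is an $\mathcal{R}_{01,02}$-graph if and only if no induced subgraph of $G$ is isomorphic to a member of $\mathcal{F}$. Likewise, there is no family $\mathcal{F}$ of graphs such that, for every graph $G$, $G$ is $\gamma_R$-excellent if and only if no induced subgraph of $G$ is isomorphic to a member of $\mathcal{F}$.
   Context: A Roman dominating function (RDF) on a graph $G$ is a map $f:V(G)\to\{0,1,2\}$ such that every vertex $v$ with $f(v)=0$ has a neighbor $u$ with $f(u)=2$; its weight is $\sum_v f(v)$. $\gamma_R(G)$ is the minimum weight of an RDF; an RDF of that weight is a $\gamma_R$-function. For $X\subseteq\{0,1,2\}$, $V^X(G)$ is the set of vertices $v$ with $\{f(v): f\text{ a }\gamma_R\text{ -function}\}=X$. $G$ is an $\mathcal{R}_{01,02}$-graph if $V(G)=V^{\{0,1\}}(G)\cup V^{\{0,2\}}(G)$ and both sets are nonempty. $G$ is $\gamma_R$-excellent if every vertex $v$ has a $\gamma_R$-function $f$ with $f(v)\neq0$. "Forbidden subgraph characterization" is interpreted as a characterization by a family of forbidden induced subgraphs. -}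

module Defs where

open import Data.Nat using (ℕ; _≤_)
open import Data.Fin using (Fin; zero; suc; toℕ)
open import Data.Bool using (Bool; true; false)
open import Data.List using (map; allFin)
open import Data.Nat.ListAction using (sum)
open import Data.Sum using (_⊎_)
open import Data.Product using (Σ; ∃; _×_; _,_)
open import Data.Empty using (⊥)
open import Relation.Nullary using (¬_)
open import Relation.Binary.PropositionalEquality using (_≡_; _≢_)
open import Function.Definitions using (Injective)

record Graph : Set where
  field
    order : ℕ
    adj   : Fin order → Fin order → Bool
    sym   : ∀ u v → adj u v ≡ adj v u
    irrefl : ∀ v → adj v v ≡ false
open Graph public

_↪ᵢ_ : Graph → Graph → Set
H ↪ᵢ G = Σ (Fin (order H) → Fin (order G)) λ φ →
           Injective _≡_ _≡_ φ × (∀ i j → adj H i j ≡ adj G (φ i) (φ j))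

Label : Set
Label = Fin 3

L0 L1 L2 : Label
L0 = zero
L1 = suc zero
L2 = suc (suc zero)

module _ (G : Graph) where
  Labelling : Set
  Labelling = Fin (order G) → Label

  IsRDF : Labelling → Set
  IsRDF f = ∀ v → f v ≡ L0 → ∃ λ u → adj G v u ≡ true × f u ≡ L2

  weight : Labelling → ℕ
  weight f = sum (map (λ v → toℕ (f v)) (allFin (order G)))

  IsγRFunction : Labelling → Set
  IsγRFunction f = IsRDF f × (∀ g → IsRDF g → weight f ≤ weight g)

  Attains : Fin (order G) → Label → Set
  Attains v k = ∃ λ f → IsγRFunction f × f v ≡ k

  InV01 : Fin (order G) → Set
  InV01 v = Attains v L0 × Attains v L1 × ¬ Attains v L2

  InV02 : Fin (order G) → Set
  InV02 v = Attains v L0 × ¬ Attains v L1 × Attains v L2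

  IsR0102 : Set
  IsR0102 = (∀ v → InV01 v ⊎ InV02 v)
            × (∃ λ v → InV01 v) × (∃ λ v → InV02 v)

  IsγRExcellent : Set
  IsγRExcellent = ∀ v → ∃ λ f → IsγRFunction f × f v ≢ L0

CharacterizedBy : (Graph → Set) → (Graph → Set) → Set
CharacterizedBy 𝒫 𝓕 = ∀ G → 1 ≤ order G →
  (𝒫 G → ¬ (∃ λ H → 𝓕 H × H ↪ᵢ G)) × (¬ (∃ λ H → 𝓕 H × H ↪ᵢ G) → 𝒫 G)

-- P₄ (path on four vertices) is an R_{01,02}-graph while its induced subgraph K₁ is not:
-- the single vertex of K₁ is labelled 1 by its unique γ_R-function. The cycle C₄ is
-- γ_R-excellent while its induced subgraph P₃ is not: the ends of P₃ are labelled 0 by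
-- its unique γ_R-function. A class with a forbidden induced subgraph characterization is
-- closed under taking induced subgraphs, so neither class has one. The four facts about
-- small graphs are verified by exhaustive search over labellings.

module Submission where

open import Defs
open import Data.Product using (_×_)
open import Relation.Nullary using (¬_)
open import Data.Product using (∃)

open import Data.Nat using (ℕ; suc; _≤_; _≤?_; _≡ᵇ_; s≤s; z≤n)
open import Data.Nat.Properties using (≤-trans)
open import Data.Fin using (Fin; zero; suc; toℕ; inject₁; _≟_)
open import Data.Fin.Properties using (all?; any?)
open import Data.Bool using (Bool; true; false; _∨_; _∧_)
import Data.Bool as Bool
open import Data.List using (allFin)
open import Data.List.Properties using (map-cong)
open import Data.Nat.ListAction using (sum)
open import Data.Product using (_,_; proj₁; proj₂)
open import Data.Vec.Functional using (_∷_; head; tail)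
open import Data.Vec.Functional.Properties using (∷-cong)
open import Function using (_∘_)
open import Function.Definitions using (Injective)
open import Relation.Nullary using (Dec; yes; no)
open import Relation.Nullary.Decidable
  using (True; map′; ¬?; _×-dec_; _⊎-dec_; _→-dec_; toWitness; from-yes; from-no; decidable-stable)
open import Relation.Binary.PropositionalEquality using (_≡_; _≗_; refl; trans; cong; subst)
  renaming (sym to ≡-sym)

↪ᵢ-trans : ∀ {F H G} → F ↪ᵢ H → H ↪ᵢ G → F ↪ᵢ G
↪ᵢ-trans (φ , φ-inj , φ-adj) (ψ , ψ-inj , ψ-adj) =
  ψ ∘ φ , φ-inj ∘ ψ-inj , λ i j → trans (φ-adj i j) (ψ-adj (φ i) (φ j))

characterized⇒hereditary : ∀ {𝒫 𝓕 : Graph → Set} → CharacterizedBy 𝒫 𝓕 →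
  ∀ H G → 1 ≤ order H → 1 ≤ order G → H ↪ᵢ G → 𝒫 G → 𝒫 H
characterized⇒hereditary ch H G 1≤H 1≤G H↪G 𝒫G =
  proj₂ (ch H 1≤H) λ (F , F∈𝓕 , F↪H) →
    proj₁ (ch G 1≤G) 𝒫G (F , F∈𝓕 , ↪ᵢ-trans {F} {H} {G} F↪H H↪G)

module _ {k : ℕ} where

  any-map? : ∀ {n} {P : (Fin n → Fin k) → Set} → (∀ {f g} → f ≗ g → P f → P g) →
             (∀ f → Dec (P f)) → Dec (∃ P)
  any-map? {0} resp P? with P? (λ ())
  ... | yes p = yes (_ , p)
  ... | no ¬p = no λ (f , pf) → ¬p (resp (λ ()) pf)
  any-map? {suc n} resp P? =
    map′ (λ (a , t , p) → a ∷ t , p)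
         (λ (f , p) → head f , tail f , resp (∷-cong refl λ _ → refl) p)
         (any? λ a → any-map? (λ eq → resp (∷-cong refl eq)) (P? ∘ (a ∷_)))

  all-maps? : ∀ {n} {P : (Fin n → Fin k) → Set} → (∀ {f g} → f ≗ g → P f → P g) →
              (∀ f → Dec (P f)) → Dec (∀ f → P f)
  all-maps? resp P? with any-map? (λ eq ¬pf → ¬pf ∘ resp (≡-sym ∘ eq)) (¬? ∘ P?)
  ... | yes (f , ¬pf) = no λ ∀p → ¬pf (∀p f)
  ... | no ∄¬p       = yes λ f → decidable-stable (P? f) λ ¬pf → ∄¬p (f , ¬pf)

graph : (n : ℕ) (a : Fin n → Fin n → Bool) →
        {True (all? λ u → all? λ v → a u v Bool.≟ a v u)} →
        {True (all? λ v → a v v Bool.≟ false)} → Graph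
graph n a {sym?} {irrefl?} = record
  { order = n ; adj = a ; sym = toWitness sym? ; irrefl = toWitness irrefl? }

pathAdj : ∀ {n} → Fin n → Fin n → Bool
pathAdj i j = (suc (toℕ i) ≡ᵇ toℕ j) ∨ (suc (toℕ j) ≡ᵇ toℕ i)

cycleAdj : ∀ {n} → Fin n → Fin n → Bool
cycleAdj {n} i j = pathAdj i j ∨ (toℕ i ≡ᵇ 0) ∧ (suc (toℕ j) ≡ᵇ n)
                               ∨ (toℕ j ≡ᵇ 0) ∧ (suc (toℕ i) ≡ᵇ n)

K₁ P₃ P₄ C₄ : Graph
K₁ = graph 1 pathAdj
P₃ = graph 3 pathAdj
P₄ = graph 4 pathAdj
C₄ = graph 4 cycleAdj

induced? : ∀ {H G} (φ : Fin (order H) → Fin (order G)) →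
           Dec (Injective _≡_ _≡_ φ × (∀ i j → adj H i j ≡ adj G (φ i) (φ j)))
induced? {H} {G} φ =
  map′ (λ inj → λ {i} {j} → inj i j) (λ inj i j → inj)
       (all? λ i → all? λ j → φ i ≟ φ j →-dec i ≟ j)
  ×-dec all? λ i → all? λ j → adj H i j Bool.≟ adj G (φ i) (φ j)

K₁↪P₄ : K₁ ↪ᵢ P₄
K₁↪P₄ = _ , from-yes (induced? {K₁} {P₄} λ _ → zero)

P₃↪C₄ : P₃ ↪ᵢ C₄
P₃↪C₄ = _ , from-yes (induced? {P₃} {C₄} inject₁)

module _ (G : Graph) where

  isRDF? : ∀ f → Dec (IsRDF G f)
  isRDF? f = all? λ v → f v ≟ L0 →-dec any? λ u → adj G v u Bool.≟ true ×-dec f u ≟ L2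

  IsRDF-resp : ∀ {f g} → f ≗ g → IsRDF G f → IsRDF G g
  IsRDF-resp f≗g rdf v gv≡0 with rdf v (trans (f≗g v) gv≡0)
  ... | u , uv , fu≡2 = u , uv , trans (≡-sym (f≗g u)) fu≡2

  weight-cong : ∀ {f g} → f ≗ g → weight G f ≡ weight G g
  weight-cong f≗g = cong sum (map-cong (cong toℕ ∘ f≗g) (allFin (order G)))

  RomanDominationNumber : ℕ → Set
  RomanDominationNumber w =
    (∃ λ f → IsRDF G f × weight G f ≡ w) × (∀ g → IsRDF G g → w ≤ weight G g)

  romanDominationNumber? : ∀ w → Dec (RomanDominationNumber w)
  romanDominationNumber? w =
    any-map? (λ eq (rdf , wt) → IsRDF-resp eq rdf , trans (≡-sym (weight-cong eq)) wt)
             (λ f → isRDF? f ×-dec weight G f Data.Nat.≟ w)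
    ×-dec all-maps? (λ eq bound rdf →
                       subst (w ≤_) (weight-cong eq) (bound (IsRDF-resp (≡-sym ∘ eq) rdf)))
                    (λ g → isRDF? g →-dec w ≤? weight G g)

  module _ {w : ℕ} (γR≡w : RomanDominationNumber w) where

    -- Once γ_R(G) is known, γ_R-functions are the RDFs of weight at most γ_R(G).
    any-γRFunction? : ∀ {P : Labelling G → Set} → (∀ {f g} → f ≗ g → P f → P g) →
                      (∀ f → Dec (P f)) → Dec (∃ λ f → IsγRFunction G f × P f)
    any-γRFunction? resp P? =
      map′ (λ (f , rdf , f≤w , p) → f , (rdf , λ g rdf-g → ≤-trans f≤w (proj₂ γR≡w g rdf-g)) , p)
           (λ (f , (rdf , min) , p) → f , rdf , minimal≤w rdf min , p)
           (any-map? (λ eq (rdf , f≤w , p) →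
                        IsRDF-resp eq rdf , subst (_≤ w) (weight-cong eq) f≤w , resp eq p)
                     λ f → isRDF? f ×-dec weight G f ≤? w ×-dec P? f)
      where
      minimal≤w : ∀ {f} → IsRDF G f → (∀ g → IsRDF G g → weight G f ≤ weight G g) → weight G f ≤ w
      minimal≤w {f} _ min with proj₁ γR≡w
      ... | f₀ , rdf₀ , f₀≡w = subst (weight G f ≤_) f₀≡w (min f₀ rdf₀)

    attains? : ∀ v k → Dec (Attains G v k)
    attains? v k = any-γRFunction? (λ eq fv≡k → trans (≡-sym (eq v)) fv≡k) (λ f → f v ≟ k)

    isR0102? : Dec (IsR0102 G)
    isR0102? = all? (λ v → inV01? v ⊎-dec inV02? v) ×-dec any? inV01? ×-dec any? inV02?
      where
      inV01? : ∀ v → Dec (InV01 G v)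
      inV02? : ∀ v → Dec (InV02 G v)
      inV01? v = attains? v L0 ×-dec attains? v L1 ×-dec ¬? (attains? v L2)
      inV02? v = attains? v L0 ×-dec ¬? (attains? v L1) ×-dec attains? v L2

    isγRExcellent? : Dec (IsγRExcellent G)
    isγRExcellent? = all? λ v → any-γRFunction? (λ eq fv≢0 → fv≢0 ∘ trans (eq v)) (λ f → ¬? (f v ≟ L0))

P₄-isR0102 : IsR0102 P₄
P₄-isR0102 = from-yes (isR0102? P₄ (from-yes (romanDominationNumber? P₄ 3)))

K₁-¬isR0102 : ¬ IsR0102 K₁
K₁-¬isR0102 = from-no (isR0102? K₁ (from-yes (romanDominationNumber? K₁ 1)))

C₄-isγRExcellent : IsγRExcellent C₄
C₄-isγRExcellent = from-yes (isγRExcellent? C₄ (from-yes (romanDominationNumber? C₄ 3)))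

P₃-¬isγRExcellent : ¬ IsγRExcellent P₃
P₃-¬isγRExcellent = from-no (isγRExcellent? P₃ (from-yes (romanDominationNumber? P₃ 2)))

corollary6p4 : (¬ ∃ λ 𝓕 → CharacterizedBy IsR0102 𝓕)
    × (¬ ∃ λ 𝓕 → CharacterizedBy IsγRExcellent 𝓕)
corollary6p4 =
  (λ (_ , ch) → K₁-¬isR0102
     (characterized⇒hereditary ch K₁ P₄ (s≤s z≤n) (s≤s z≤n) K₁↪P₄ P₄-isR0102)) ,
  (λ (_ , ch) → P₃-¬isγRExcellent
     (characterized⇒hereditary ch P₃ C₄ (s≤s z≤n) (s≤s z≤n) P₃↪C₄ C₄-isγRExcellent))
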